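{- Let $S$ be a sorting sequence with $r>1$ distinct values and multiplicities $p_1,\dots,p_r$, and $c=\gcd(p_1,\dots,p_r)$. Starting from any general solution for $S$, the redistribution procedure can only be carried out a finite number of times in succession.
   Context: A sorting sequence of length $p$ is a non-decreasing sequence of $p$ non-negative integers beginning with $0$ in which each entry equals the previous one or exceeds it by $1$. If its distinct entries are $0,\dots,r-1$, let $p_i\ge1$ be the number of entries equal to $i-1$. A general solution is an integer tuple $(f_1,\dots,f_r)$ with $0\le f_1<\dots<f_r$ (total $f=\sum_ip_if_i$). The redistribution procedure applies to a general solution when some $i\in\{1,\dots,r-1\}$ satisfies $f_{i+1}>f_i+(p_i+p_{i+1})/c$, and replaces $f_{i+1}$ by $f_{i+1}-p_i/c$ and $f_i$ by $f_i+p_{i+1}/c$, leaving the other entries unchanged; the result is again a general solution. -}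

module Defs where

open import Data.Nat as ℕ using (ℕ; zero; suc; _⊔_; _≟_)
open import Data.Nat.DivMod using (_/_)
open import Data.Nat.GCD using (gcd)
open import Data.Integer as ℤ using (ℤ; +_)
open import Data.Fin using (Fin; toℕ)
open import Data.Fin using () renaming (_<_ to _<ᶠ_)
open import Data.List using (List; []; _∷_; length; filter; foldr; map; upTo)
open import Data.Sum using (_⊎_)
open import Data.Unit using (⊤)
open import Data.Product using (_×_; ∃-syntax)
open import Relation.Binary.PropositionalEquality using (_≡_; _≢_)

Steps : ℕ → List ℕ → Set
Steps a []       = ⊤
Steps a (b ∷ xs) = (b ≡ a ⊎ b ≡ suc a) × Steps b xs

SortingSeq : List ℕ → Set
SortingSeq s = ∃[ t ] (s ≡ 0 ∷ t × Steps 0 t)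

-- Number r of distinct values: the distinct entries are 0,…,r-1, so r = max + 1.
numVals : List ℕ → ℕ
numVals s = suc (foldr _⊔_ 0 s)

-- Multiplicity p_{i+1} = number of entries equal to i  (0-indexed: mult s i for i : Fin r).
mult : (s : List ℕ) → Fin (numVals s) → ℕ
mult s i = length (filter (_≟ toℕ i) s)

gcdList : List ℕ → ℕ
gcdList = foldr gcd 0

cOf : List ℕ → ℕ
cOf s = gcdList (map (λ k → length (filter (_≟ k) s)) (upTo (numVals s)))

-- natural-number division, total (division by 0 returns 0; never used since c ≥ 1)
divBy : ℕ → ℕ → ℕ
divBy n zero    = 0
divBy n (suc k) = n / suc k

GeneralSolution : (s : List ℕ) → (Fin (numVals s) → ℤ) → Set
GeneralSolution s f = (∀ i → + 0 ℤ.≤ f i) × (∀ i j → i <ᶠ j → f i ℤ.< f j)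

Redistribute : (s : List ℕ) → (f g : Fin (numVals s) → ℤ) → Set
Redistribute s f g =
  ∃[ i ] ∃[ j ]
    ( toℕ j ≡ suc (toℕ i)
    × f i ℤ.+ + divBy (mult s i ℕ.+ mult s j) (cOf s) ℤ.< f j
    × g j ≡ f j ℤ.- + divBy (mult s i) (cOf s)
    × g i ≡ f i ℤ.+ + divBy (mult s j) (cOf s)
    × (∀ k → k ≢ i → k ≢ j → g k ≡ f k) )

-- With weights q_k = p_k / c (positive integers, since c divides every p_k ≥ 1), the
-- potential Φ(f) = Σ_k q_k f_k² is a non-negative integer.  A redistribution at (i, i+1)
-- lowers Φ by exactly q_i q_{i+1} (2(f_{i+1} − f_i) − q_i − q_{i+1}), which is positive
-- because f_{i+1} − f_i exceeds (p_i + p_{i+1})/c ≥ max(q_i, q_{i+1}).  Hence Φ strictly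
-- decreases along any run of the procedure, so every run is finite.
module Submission where

open import Defs
open import Data.Nat as ℕ using (ℕ; zero; suc; _⊔_; _≟_; z≤n)
import Data.Nat.Properties as ℕ
open import Data.Nat.DivMod using (/-monoˡ-≤; m≥n⇒m/n>0)
open import Data.Nat.Divisibility using (_∣_; ∣-trans; ∣⇒≤; 0∣⇒≡0)
open import Data.Nat.GCD using (gcd[m,n]∣m; gcd[m,n]∣n)
open import Data.Integer as ℤ using (ℤ; +_; 0ℤ; _+_; _-_; _*_; _<_; _≤_; ∣_∣)
open import Data.Integer.Properties as ℤ
  using (+-0-abelianGroup; +-0-commutativeMonoid; +-commutativeSemigroup; +-assoc; +-identityʳ; +-inverseʳ;
         +-mono-≤; +-mono-<; +-monoˡ-<; +-monoʳ-<; +-monoʳ-≤; ≤-<-trans; *-zeroʳ; *-monoˡ-<-pos; pos-*;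
         0≤i⇒+∣i∣≡i; drop‿+<+)
open import Data.Integer.Base using (positive)
open import Data.Integer.Tactic.RingSolver using (solve-∀)
open import Data.Fin using (Fin; toℕ; punchIn) renaming (_≟_ to _≟ᶠ_)
open import Data.Fin.Properties using (punchInᵢ≢i; toℕ<n)
open import Data.Vec.Functional using (removeAt; updateAt; tail)
open import Data.Vec.Functional.Properties using (updateAt-updates; updateAt-minimal)
open import Data.List using (List; []; _∷_; length; filter; foldr)
open import Data.List.Membership.Propositional using (_∈_)
open import Data.List.Membership.Propositional.Properties using (∈-filter⁺; ∈-length; ∈-map⁺; ∈-upTo⁺)
open import Data.List.Relation.Unary.Any using (here; there)
open import Data.Sum using (_⊎_; inj₁; inj₂)
open import Data.Product using (_,_)
open import Function using (_∘_; const)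
open import Induction.WellFounded using (Acc; module Subrelation)
open import Data.Nat.Induction using (<-wellFounded)
import Relation.Binary.Construct.On as On
open import Relation.Binary.PropositionalEquality
  using (_≡_; _≢_; refl; sym; trans; cong; subst; subst₂; module ≡-Reasoning)
open import Relation.Nullary using (yes; no; contradiction)

open import Algebra.Properties.CommutativeMonoid.Sum +-0-commutativeMonoid using (sum; sum-remove; sum-cong-≗)
open import Algebra.Properties.CommutativeSemigroup +-commutativeSemigroup using (xy∙z≈zy∙x; xy∙z≈xz∙y; xy∙z≈x∙zy)
open import Algebra.Properties.AbelianGroup +-0-abelianGroup using (∙-cancelʳ)

0≤i*i : ∀ i → 0ℤ ≤ i * i
0≤i*i (+ n)        = subst (0ℤ ≤_) (pos-* n n) (ℤ.+≤+ z≤n)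
0≤i*i ℤ.-[1+ n ]   = ℤ.+≤+ z≤n

i<j⇒0<j-i : ∀ {i j} → i < j → 0ℤ < j - i
i<j⇒0<j-i {i} {j} i<j = subst (_< j - i) (+-inverseʳ i) (+-monoˡ-< (ℤ.- i) i<j)

0<i⇒0<j⇒0<i*j : ∀ {i j} → 0ℤ < i → 0ℤ < j → 0ℤ < i * j
0<i⇒0<j⇒0<i*j {i} 0<i 0<j = subst (_< i * _) (*-zeroʳ i) (*-monoˡ-<-pos i {{positive 0<i}} 0<j)

0≤i⇒i<j⇒∣i∣<∣j∣ : ∀ {i j} → 0ℤ ≤ i → i < j → ∣ i ∣ ℕ.< ∣ j ∣
0≤i⇒i<j⇒∣i∣<∣j∣ 0≤i i<j =
  drop‿+<+ (subst₂ _<_ (sym (0≤i⇒+∣i∣≡i 0≤i)) (sym (0≤i⇒+∣i∣≡i (ℤ.≤-trans 0≤i (ℤ.<⇒≤ i<j)))) i<j)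

sum-≗-except : ∀ {n} (f g : Fin (suc n) → ℤ) i → (∀ k → k ≢ i → g k ≡ f k) →
               sum g + f i ≡ sum f + g i
sum-≗-except f g i agree = begin
  sum g + f i                       ≡⟨ cong (_+ f i) (sum-remove {i = i} g) ⟩
  (g i + sum (removeAt g i)) + f i  ≡⟨ cong (λ σ → (g i + σ) + f i) removed-agree ⟩
  (g i + sum (removeAt f i)) + f i  ≡⟨ xy∙z≈zy∙x (g i) _ (f i) ⟩
  (f i + sum (removeAt f i)) + g i  ≡⟨ cong (_+ g i) (sum-remove {i = i} f) ⟨
  sum f + g i                       ∎
  where
  open ≡-Reasoning
  removed-agree : sum (removeAt g i) ≡ sum (removeAt f i)
  removed-agree = sum-cong-≗ λ k → agree (punchIn i k) (punchInᵢ≢i i k)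

sum-≗-except₂ : ∀ {n} (f g : Fin (suc n) → ℤ) {i j} → i ≢ j →
                (∀ k → k ≢ i → k ≢ j → g k ≡ f k) →
                sum g + (f i + f j) ≡ sum f + (g i + g j)
sum-≗-except₂ f g {i} {j} i≢j agree = begin
  sum g + (f i + f j)  ≡⟨ cong (λ x → sum g + x) (ℤ.+-comm (f i) (f j)) ⟩
  sum g + (f j + f i)  ≡⟨ +-assoc (sum g) (f j) (f i) ⟨
  (sum g + f j) + f i  ≡⟨ cong (_+ f i) g-vs-h ⟩
  (sum h + g j) + f i  ≡⟨ xy∙z≈xz∙y (sum h) (g j) (f i) ⟩
  (sum h + f i) + g j  ≡⟨ cong (_+ g j) h-vs-f ⟩
  (sum f + g i) + g j  ≡⟨ +-assoc (sum f) (g i) (g j) ⟩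
  sum f + (g i + g j)  ∎
  where
  open ≡-Reasoning
  h : Fin _ → ℤ
  h = updateAt g j (const (f j))
  h≡g : ∀ k → k ≢ j → h k ≡ g k
  h≡g k k≢j = updateAt-minimal k j g k≢j
  h≡f : ∀ k → k ≢ i → h k ≡ f k
  h≡f k k≢i with k ≟ᶠ j
  ... | yes refl = updateAt-updates j g
  ... | no k≢j   = trans (h≡g k k≢j) (agree k k≢i k≢j)
  g-vs-h : sum g + f j ≡ sum h + g j
  g-vs-h = subst (λ x → sum g + x ≡ sum h + g j) (h≡f j (i≢j ∘ sym))
                 (sum-≗-except h g j λ k k≢j → sym (h≡g k k≢j))
  h-vs-f : sum h + f i ≡ sum f + g i
  h-vs-f = subst (λ x → sum h + f i ≡ sum f + x) (h≡g i i≢j) (sum-≗-except f h i h≡f)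

sum-nonneg : ∀ {n} (t : Fin n → ℤ) → (∀ k → 0ℤ ≤ t k) → 0ℤ ≤ sum t
sum-nonneg {zero}  t t≥0 = ℤ.≤-refl
sum-nonneg {suc n} t t≥0 = +-mono-≤ (t≥0 Fin.zero) (sum-nonneg (tail t) (t≥0 ∘ Fin.suc))

weightedSquareSum : ∀ {n} → (Fin n → ℕ) → (Fin n → ℤ) → ℤ
weightedSquareSum w f = sum λ k → + w k * (f k * f k)

weightedSquareSum-nonneg : ∀ {n} (w : Fin n → ℕ) (f : Fin n → ℤ) → 0ℤ ≤ weightedSquareSum w f
weightedSquareSum-nonneg w f = sum-nonneg _ λ k →
  subst (_≤ + w k * (f k * f k)) (*-zeroʳ (+ w k)) (ℤ.*-monoˡ-≤-nonNeg (+ w k) (0≤i*i (f k)))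

transfer-identity : ∀ x y a b →
  b * (x * x) + a * (y * y) ≡
  (b * ((x + a) * (x + a)) + a * ((y - b) * (y - b))) + (a * b) * ((y - (x + b)) + (y - (x + a)))
transfer-identity = solve-∀

weightedSquareSum-transfer-< : ∀ {n} (w : Fin (suc n) → ℕ) {f g : Fin (suc n) → ℤ} {i j} → i ≢ j →
  0 ℕ.< w i → 0 ℕ.< w j → f i + + w i < f j → f i + + w j < f j →
  g i ≡ f i + + w j → g j ≡ f j - + w i → (∀ k → k ≢ i → k ≢ j → g k ≡ f k) →
  weightedSquareSum w g < weightedSquareSum w f
weightedSquareSum-transfer-< w {f} {g} {i} {j} i≢j 0<wi 0<wj fi+wi<fj fi+wj<fj gi gj agree =
  subst₂ _<_ (+-identityʳ Φg) Φg+gain≡Φf (+-monoʳ-< Φg 0<gain)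
  where
  sq : (Fin _ → ℤ) → Fin _ → ℤ
  sq h k = + w k * (h k * h k)
  Φf Φg : ℤ
  Φf = weightedSquareSum w f
  Φg = weightedSquareSum w g
  gain : ℤ
  gain = (+ w j * + w i) * ((f j - (f i + + w i)) + (f j - (f i + + w j)))
  0<gain : 0ℤ < gain
  0<gain = 0<i⇒0<j⇒0<i*j (0<i⇒0<j⇒0<i*j (ℤ.+<+ 0<wj) (ℤ.+<+ 0<wi))
                         (+-mono-< (i<j⇒0<j-i fi+wi<fj) (i<j⇒0<j-i fi+wj<fj))
  two-point-drop : sq f i + sq f j ≡ (sq g i + sq g j) + gain
  two-point-drop rewrite gi | gj = transfer-identity (f i) (f j) (+ w j) (+ w i)
  Φg+gain≡Φf : Φg + gain ≡ Φf
  Φg+gain≡Φf = ∙-cancelʳ (sq g i + sq g j) _ _ (begin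
    (Φg + gain) + (sq g i + sq g j)  ≡⟨ xy∙z≈x∙zy Φg gain _ ⟩
    Φg + ((sq g i + sq g j) + gain)  ≡⟨ cong (λ x → Φg + x) two-point-drop ⟨
    Φg + (sq f i + sq f j)           ≡⟨ sum-≗-except₂ (sq f) (sq g) i≢j (λ k k≢i k≢j →
                                          cong (λ x → + w k * (x * x)) (agree k k≢i k≢j)) ⟩
    Φf + (sq g i + sq g j)           ∎)
    where open ≡-Reasoning

m<k∧k≤m⊔n⇒k≤n : ∀ {m n k} → m ℕ.< k → k ℕ.≤ m ⊔ n → k ℕ.≤ n
m<k∧k≤m⊔n⇒k≤n {m} {n} m<k k≤m⊔n with ℕ.⊔-sel m n
... | inj₁ m⊔n≡m = contradiction (subst (_ ℕ.≤_) m⊔n≡m k≤m⊔n) (ℕ.<⇒≱ m<k)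
... | inj₂ m⊔n≡n = subst (_ ℕ.≤_) m⊔n≡n k≤m⊔n

step-≤ : ∀ {a b k} → b ≡ a ⊎ b ≡ suc a → a ℕ.< k → b ℕ.≤ k
step-≤ (inj₁ refl) a<k = ℕ.<⇒≤ a<k
step-≤ (inj₂ refl) a<k = a<k

Steps-∈ : ∀ {a t} → Steps a t → ∀ {k} → a ℕ.≤ k → k ℕ.≤ a ⊔ foldr _⊔_ 0 t → k ∈ a ∷ t
Steps-∈ {a} {[]} _ a≤k k≤a⊔0 = here (ℕ.≤-antisym (subst (_ ℕ.≤_) (ℕ.⊔-identityʳ a) k≤a⊔0) a≤k)
Steps-∈ {a} {b ∷ t} (b≡a∨b≡1+a , steps) {k} a≤k k≤max with a ≟ k
... | yes refl = here refl
... | no a≢k   = there (Steps-∈ steps (step-≤ b≡a∨b≡1+a a<k) (m<k∧k≤m⊔n⇒k≤n a<k k≤max))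
  where
  a<k : a ℕ.< k
  a<k = ℕ.≤∧≢⇒< a≤k a≢k

SortingSeq-∈ : ∀ {s} → SortingSeq s → (k : Fin (numVals s)) → toℕ k ∈ s
SortingSeq-∈ (t , refl , steps) k = Steps-∈ steps z≤n (ℕ.≤-pred (toℕ<n k))

mult-pos : ∀ {s} → SortingSeq s → (k : Fin (numVals s)) → 0 ℕ.< mult s k
mult-pos sorted k = ∈-length (∈-filter⁺ (_≟ toℕ k) (SortingSeq-∈ sorted k) refl)

gcdList-∣ : ∀ {x xs} → x ∈ xs → gcdList xs ∣ x
gcdList-∣ {xs = y ∷ ys} (here refl) = gcd[m,n]∣m y (gcdList ys)
gcdList-∣ {xs = y ∷ ys} (there x∈ys) = ∣-trans (gcd[m,n]∣n y (gcdList ys)) (gcdList-∣ x∈ys)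

cOf-∣-mult : ∀ s (k : Fin (numVals s)) → cOf s ∣ mult s k
cOf-∣-mult s k = gcdList-∣ (∈-map⁺ (λ m → length (filter (_≟ m) s)) (∈-upTo⁺ (toℕ<n k)))

divBy-pos : ∀ {p c} → c ∣ p → 0 ℕ.< p → 0 ℕ.< divBy p c
divBy-pos {c = zero}  0∣p   0<p = contradiction (0∣⇒≡0 0∣p) (ℕ.>⇒≢ 0<p)
divBy-pos {c = suc c} c+1∣p 0<p = m≥n⇒m/n>0 (∣⇒≤ {{ℕ.>-nonZero 0<p}} c+1∣p)

divBy-monoˡ-≤ : ∀ {m n} c → m ℕ.≤ n → divBy m c ℕ.≤ divBy n c
divBy-monoˡ-≤ zero    m≤n = z≤n
divBy-monoˡ-≤ (suc c) m≤n = /-monoˡ-≤ (suc c) m≤n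

reducedMult : (s : List ℕ) → Fin (numVals s) → ℕ
reducedMult s k = divBy (mult s k) (cOf s)

reducedMult-pos : ∀ {s} → SortingSeq s → (k : Fin (numVals s)) → 0 ℕ.< reducedMult s k
reducedMult-pos {s} sorted k = divBy-pos (cOf-∣-mult s k) (mult-pos sorted k)

Redistribute⇒weightedSquareSum-< : ∀ {s} → SortingSeq s → ∀ {f g} → Redistribute s f g →
  weightedSquareSum (reducedMult s) g < weightedSquareSum (reducedMult s) f
Redistribute⇒weightedSquareSum-< {s} sorted {f} (i , j , j≡1+i , fi+d<fj , gj , gi , agree) =
  weightedSquareSum-transfer-< (reducedMult s) i≢j
    (reducedMult-pos sorted i) (reducedMult-pos sorted j)
    (below-threshold (ℕ.m≤m+n (mult s i) (mult s j)))
    (below-threshold (ℕ.m≤n+m (mult s j) (mult s i)))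
    gi gj agree
  where
  i≢j : i ≢ j
  i≢j i≡j = ℕ.1+n≢n (sym (trans (cong toℕ i≡j) j≡1+i))
  below-threshold : ∀ {p} → p ℕ.≤ mult s i ℕ.+ mult s j → f i + + divBy p (cOf s) < f j
  below-threshold p≤ = ≤-<-trans (+-monoʳ-≤ (f i) (ℤ.+≤+ (divBy-monoˡ-≤ (cOf s) p≤))) fi+d<fj

mainTheorem19 : (s : List ℕ) → SortingSeq s → 1 ℕ.< numVals s →
    (f : Fin (numVals s) → ℤ) → GeneralSolution s f →
    Acc (λ g h → Redistribute s h g) f
mainTheorem19 s sorted _ f _ =
  Subrelation.accessible potential-decreases (On.accessible potential (<-wellFounded (potential f)))
  where
  potential : (Fin (numVals s) → ℤ) → ℕ
  potential h = ∣ weightedSquareSum (reducedMult s) h ∣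
  potential-decreases : ∀ {g h} → Redistribute s h g → potential g ℕ.< potential h
  potential-decreases {g} step =
    0≤i⇒i<j⇒∣i∣<∣j∣ (weightedSquareSum-nonneg (reducedMult s) g) (Redistribute⇒weightedSquareSum-< sorted step)
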